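{- Let $d$ be a degree sequence and let $R_1,R_2,R_3,R_4$ be four distinct labeled realizations of $d$ that are pairwise adjacent in the realization graph $\mathcal{G}(d)$. For $I\subseteq\{1,2,3,4\}$ let $s_I$ denote the number of vertex pairs that are edges in $R_i$ for every $i\in I$ and are non-edges in $R_j$ for every $j\notin I$. Then $s_I\le 1$ for every $I$ with $I\neq\emptyset$ and $I\neq\{1,2,3,4\}$.
   Context: All graphs are finite and simple. A labeled realization of a degree sequence $d=(d_1,\dots,d_n)$ is a graph on the fixed vertex set $\{v_1,\dots,v_n\}$ in which $v_i$ has degree $d_i$. An alternating 4-cycle $[u,v:w,x]$ in a graph $H$ consists of four distinct vertices $u,v,w,x$ with $uv,wx\in E(H)$ and $ux,vw\notin E(H)$. A 2-switch on it deletes $uv,wx$ and adds $ux,vw$. The realization graph $\mathcal{G}(d)$ has the labeled realizations of $d$ as vertices, two being adjacent when one is obtained from the other by a single 2-switch. -}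

module Defs where

open import Data.Nat using (ℕ; zero; suc; _<_)
open import Data.Fin using (Fin; toℕ)
open import Data.Fin.Properties using () renaming (_≟_ to _≟F_)
open import Data.Bool using (Bool; true; false; _∧_; if_then_else_)
open import Data.List using (List; []; _∷_; map; concatMap; allFin)
open import Data.Bool.ListAction using (and)
open import Data.Product using (Σ; ∃; ∃-syntax; _×_; _,_)
open import Relation.Binary.PropositionalEquality using (_≡_; _≢_)
open import Relation.Nullary using (¬_; does)
open import Data.Nat.Properties using (_<?_)
open import Data.Bool.Properties using () renaming (_≟_ to _≟B_)

Adj : ℕ → Set
Adj n = Fin n → Fin n → Bool

record Graph (n : ℕ) : Set where
  field
    adj   : Adj n
    sym   : ∀ a b → adj a b ≡ adj b a
    irrefl : ∀ a → adj a a ≡ false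
open Graph public

countTrue : List Bool → ℕ
countTrue [] = 0
countTrue (true ∷ bs) = suc (countTrue bs)
countTrue (false ∷ bs) = countTrue bs

degree : ∀ {n} → Graph n → Fin n → ℕ
degree {n} G i = countTrue (map (adj G i) (allFin n))

IsRealization : ∀ {n} → (Fin n → ℕ) → Graph n → Set
IsRealization d G = ∀ i → degree G i ≡ d i

-- H is obtained from G by the 2-switch on the alternating 4-cycle [u,v:w,x]:
-- uv, wx ∈ E(G), ux, vw ∉ E(G), u v w x distinct, and H equals G with
-- uv, wx deleted and ux, vw added.
sameEdge : ∀ {n} → Fin n → Fin n → Fin n → Fin n → Bool
sameEdge a b p q =
  (does (a ≟F p) ∧ does (b ≟F q)) Data.Bool.∨ (does (a ≟F q) ∧ does (b ≟F p))

TwoSwitch : ∀ {n} → Graph n → Graph n → Set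
TwoSwitch {n} G H =
  Σ (Fin n) λ u → Σ (Fin n) λ v → Σ (Fin n) λ w → Σ (Fin n) λ x →
    (u ≢ v) × (u ≢ w) × (u ≢ x) × (v ≢ w) × (v ≢ x) × (w ≢ x) ×
    (adj G u v ≡ true) × (adj G w x ≡ true) ×
    (adj G u x ≡ false) × (adj G v w ≡ false) ×
    (∀ a b → adj H a b ≡
       (if sameEdge a b u v Data.Bool.∨ sameEdge a b w x then false
        else if sameEdge a b u x Data.Bool.∨ sameEdge a b v w then true
        else adj G a b))

AdjRG : ∀ {n} → Graph n → Graph n → Set
AdjRG G H = TwoSwitch G H Data.Sum.⊎ TwoSwitch H G
  where import Data.Sum

SameGraph : ∀ {n} → Graph n → Graph n → Set
SameGraph G H = ∀ a b → adj G a b ≡ adj H a b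

pairs : (n : ℕ) → List (Fin n × Fin n)
pairs n = concatMap (λ a → concatMap (λ b →
            if does (toℕ a <? toℕ b) then (a , b) ∷ [] else []) (allFin n)) (allFin n)

sI : ∀ {n} → (Fin 4 → Graph n) → (Fin 4 → Bool) → ℕ
sI {n} R I = countTrue (map (λ p → inPattern p) (pairs n))
  where
  inPattern : Fin n × Fin n → Bool
  inPattern (a , b) = and (map (λ i → does (adj (R i) a b ≟B I i)) (allFin 4))

-- Suppose two distinct pairs ab and cd had the same proper pattern I. A 2-switch from a
-- realization containing both pairs to one containing neither must delete exactly ab and cd,
-- so it is [a,b:c,d] or [a,b:d,c]: one bit of freedom. A 2-switch is determined by its
-- alternating cycle and either end, so two switches with the same bit and a common end have
-- the same other end. If |I| = 1 or |I| = 3, one realization is switched to three others, two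
-- of the three bits agree, and distinctness fails. If |I| = 2, with R_k, R_l inside and R_m, R_o
-- outside, the bits of R_k→R_m, R_l→R_m, R_l→R_o again contain an equal pair; the one case not
-- covered above has R_k→R_m and R_l→R_o agreeing against R_l→R_m, and is impossible: R_k→R_m
-- adds a diagonal (ad or ac) that R_l→R_m leaves untouched, so R_l has it, yet R_l→R_o needs
-- it absent.

module Submission where

open import Defs
open import Data.Nat using (ℕ; suc; _≤_; _<_; z≤n)
open import Data.Nat.Properties using (≤-reflexive; <-asym; _<?_)
open import Data.Fin using (Fin; toℕ)
open import Data.Fin.Patterns using (0F; 1F; 2F; 3F)
open import Data.Fin.Properties using () renaming (_≟_ to _≟F_)
open import Data.Bool using (Bool; true; false; _∧_; _∨_; if_then_else_)
open import Data.Bool.Properties using (∨-comm; ∨-zeroʳ; ∧-zeroʳ; ∧-conicalˡ; ∧-conicalʳ) renaming (_≟_ to _≟B_)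
open import Data.Bool.ListAction using (and)
open import Data.Product using (Σ; ∃; ∃₂; _×_; _,_; proj₁; proj₂)
open import Data.Sum using (_⊎_; inj₁; inj₂)
open import Data.List using (List; []; _∷_; map; concat; concatMap; filter; allFin)
open import Data.List.Properties using (map-cong)
open import Data.List.Membership.Propositional using (_∈_)
open import Data.List.Membership.Propositional.Properties using (∈-map⁻; ∈-filter⁻; ∈-concat⁻′; ∈-allFin)
open import Data.List.Relation.Unary.Any using (here; there)
import Data.List.Relation.Unary.All as All
import Data.List.Relation.Unary.All.Properties as All
import Data.List.Relation.Unary.AllPairs as AllPairs
import Data.List.Relation.Unary.AllPairs.Properties as AllPairs
open import Data.List.Relation.Unary.Unique.Propositional using (Unique)
import Data.List.Relation.Unary.Unique.Propositional.Properties as Unique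
open import Data.List.Relation.Binary.Disjoint.Propositional using (Disjoint)
open import Data.Empty using (⊥; ⊥-elim)
open import Relation.Binary.PropositionalEquality as ≡ using (_≡_; _≢_; refl; trans; cong; cong₂; subst; ≢-sym)
open import Relation.Nullary using (¬_; Dec; does; yes; no)
open import Relation.Unary using (Decidable)
open import Function using (_∘_)
open import Relation.Nullary.Decidable using (dec-true; dec-false; False; toWitnessFalse)

private variable
  A B : Set
  n : ℕ
  a b c d p q u v w x : Fin n
  G H G₁ G₂ H₁ H₂ : Graph n

data SamePair {n} (a b : Fin n) : Fin n → Fin n → Set where
  same    : SamePair a b a b
  swapped : SamePair a b b a

sameEdge⇒SamePair : sameEdge a b p q ≡ true → SamePair a b p q
sameEdge⇒SamePair {a = a} {b} {p} {q} h with a ≟F p | b ≟F q | a ≟F q | b ≟F p | h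
... | yes refl | yes refl | _        | _        | _ = same
... | _        | _        | yes refl | yes refl | _ = swapped
... | yes _    | no _     | yes _    | no _     | ()
... | yes _    | no _     | no _     | _        | ()
... | no _     | _        | yes _    | no _     | ()
... | no _     | _        | no _     | _        | ()

sameEdge-comm : (a b p q : Fin n) → sameEdge a b p q ≡ sameEdge a b q p
sameEdge-comm a b p q = ∨-comm (does (a ≟F p) ∧ does (b ≟F q)) _

sameEdge-refl : (a b : Fin n) → sameEdge a b a b ≡ true
sameEdge-refl a b rewrite dec-true (a ≟F a) refl | dec-true (b ≟F b) refl = refl

sameEdge-absentˡ : ∀ b → a ≢ p → a ≢ q → sameEdge a b p q ≡ false
sameEdge-absentˡ {a = a} {p} {q} _ a≢p a≢q
  rewrite dec-false (a ≟F p) a≢p | dec-false (a ≟F q) a≢q = refl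

sameEdge-absentʳ : ∀ a → b ≢ p → b ≢ q → sameEdge a b p q ≡ false
sameEdge-absentʳ {b = b} {p} {q} a b≢p b≢q
  rewrite dec-false (b ≟F p) b≢p | dec-false (b ≟F q) b≢q
        | ∧-zeroʳ (does (a ≟F p)) | ∧-zeroʳ (does (a ≟F q)) = refl

adj-SamePair : (G : Graph n) → SamePair a b p q → adj G a b ≡ adj G p q
adj-SamePair G same    = refl
adj-SamePair G swapped = sym G _ _

sameEdge-∨⇒SamePair : (a b p q p′ q′ : Fin n) → sameEdge a b p q ∨ sameEdge a b p′ q′ ≡ true →
                      SamePair a b p q ⊎ SamePair a b p′ q′
sameEdge-∨⇒SamePair a b p q p′ q′ h with sameEdge a b p q in e
... | true  = inj₁ (sameEdge⇒SamePair e)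
... | false = inj₂ (sameEdge⇒SamePair h)

deleted added : (u v w x : Fin n) → Fin n → Fin n → Bool
deleted u v w x a b = sameEdge a b u v ∨ sameEdge a b w x
added   u v w x a b = sameEdge a b u x ∨ sameEdge a b v w

switch : Graph n → (u v w x : Fin n) → Adj n
switch G u v w x a b =
  if deleted u v w x a b then false else if added u v w x a b then true else adj G a b

switch-cong : ∀ (G : Graph n) {u v w x u′ v′ w′ x′} a b →
              deleted u v w x a b ≡ deleted u′ v′ w′ x′ a b → added u v w x a b ≡ added u′ v′ w′ x′ a b →
              switch G u v w x a b ≡ switch G u′ v′ w′ x′ a b
switch-cong G a b = cong₂ (λ del add → if del then false else if add then true else adj G a b)

record Switch (G H : Graph n) (u v w x : Fin n) : Set where
  constructor mkSwitch
  field
    u≢v : u ≢ v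
    u≢w : u ≢ w
    u≢x : u ≢ x
    v≢w : v ≢ w
    v≢x : v ≢ x
    w≢x : w ≢ x
    uv∈G : adj G u v ≡ true
    wx∈G : adj G w x ≡ true
    ux∉G : adj G u x ≡ false
    vw∉G : adj G v w ≡ false
    H≗switch : ∀ a b → adj H a b ≡ switch G u v w x a b

TwoSwitch⇒Switch : TwoSwitch G H → ∃₂ λ u v → ∃₂ λ w x → Switch G H u v w x
TwoSwitch⇒Switch (u , v , w , x , u≢v , u≢w , u≢x , v≢w , v≢x , w≢x , uv , wx , ux , vw , H≗) =
  u , v , w , x , mkSwitch u≢v u≢w u≢x v≢w v≢x w≢x uv wx ux vw H≗

module _ {G H : Graph n} {u v w x : Fin n} (s : Switch G H u v w x) where
  open Switch s

  H-deleted : ∀ a b → deleted u v w x a b ≡ true → adj H a b ≡ false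
  H-deleted a b del rewrite H≗switch a b | del = refl

  H-added : ∀ a b → deleted u v w x a b ≡ false → added u v w x a b ≡ true → adj H a b ≡ true
  H-added a b del add rewrite H≗switch a b | del | add = refl

  H-kept : ∀ a b → deleted u v w x a b ≡ false → added u v w x a b ≡ false → adj H a b ≡ adj G a b
  H-kept a b del add rewrite H≗switch a b | del | add = refl

  lost-edge : adj G a b ≡ true → adj H a b ≡ false → SamePair a b u v ⊎ SamePair a b w x
  lost-edge {a} {b} ab∈G ab∉H with deleted u v w x a b in del
  ... | true = sameEdge-∨⇒SamePair a b u v w x del
  ... | false with added u v w x a b in add
  ...   | true  with () ← trans (≡.sym (H-added a b del add)) ab∉H
  ...   | false with () ← trans (≡.sym ab∈G) (trans (≡.sym (H-kept a b del add)) ab∉H)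

  G-deleted : ∀ a b → deleted u v w x a b ≡ true → adj G a b ≡ true
  G-deleted a b del with sameEdge-∨⇒SamePair a b u v w x del
  ... | inj₁ ab≈uv = trans (adj-SamePair G ab≈uv) uv∈G
  ... | inj₂ ab≈wx = trans (adj-SamePair G ab≈wx) wx∈G

  G-added : ∀ a b → added u v w x a b ≡ true → adj G a b ≡ false
  G-added a b add with sameEdge-∨⇒SamePair a b u x v w add
  ... | inj₁ ab≈ux = trans (adj-SamePair G ab≈ux) ux∉G
  ... | inj₂ ab≈vw = trans (adj-SamePair G ab≈vw) vw∉G

  uv∉H : adj H u v ≡ false
  uv∉H = H-deleted u v (cong (_∨ sameEdge u v w x) (sameEdge-refl u v))

  wx∉H : adj H w x ≡ false
  wx∉H = H-deleted w x (trans (cong (sameEdge w x u v ∨_) (sameEdge-refl w x)) (∨-zeroʳ _))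

  ux∈H : adj H u x ≡ true
  ux∈H = H-added u x
    (cong₂ _∨_ (sameEdge-absentʳ u (≢-sym u≢x) (≢-sym v≢x)) (sameEdge-absentˡ x u≢w u≢x))
    (cong (_∨ sameEdge u x v w) (sameEdge-refl u x))

  vw∈H : adj H v w ≡ true
  vw∈H = H-added v w
    (cong₂ _∨_ (sameEdge-absentʳ v (≢-sym u≢w) (≢-sym v≢w)) (sameEdge-absentˡ w v≢w v≢x))
    (trans (cong (sameEdge v w u x ∨_) (sameEdge-refl v w)) (∨-zeroʳ _))

  uw-unchanged : adj H u w ≡ adj G u w
  uw-unchanged = H-kept u w
    (cong₂ _∨_ (sameEdge-absentʳ u (≢-sym u≢w) (≢-sym v≢w)) (sameEdge-absentˡ w u≢w u≢x))
    (cong₂ _∨_ (sameEdge-absentʳ u (≢-sym u≢w) w≢x) (sameEdge-absentˡ w u≢v u≢w))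

Switch-mirror : Switch G H u v w x → Switch G H v u x w
Switch-mirror {G = G} {H} {u} {v} {w} {x} s =
  mkSwitch (≢-sym u≢v) v≢x v≢w u≢x u≢w (≢-sym w≢x)
    (trans (sym G v u) uv∈G) (trans (sym G x w) wx∈G) vw∉G ux∉G H≗switch′
  where
  open Switch s
  H≗switch′ : ∀ a b → adj H a b ≡ switch G v u x w a b
  H≗switch′ a b = trans (H≗switch a b) (switch-cong G a b
      (cong₂ _∨_ (sameEdge-comm a b u v) (sameEdge-comm a b w x))
      (∨-comm (sameEdge a b u x) _))

Switch-rotate : Switch G H u v w x → Switch G H w x u v
Switch-rotate {G = G} {H} {u} {v} {w} {x} s =
  mkSwitch w≢x (≢-sym u≢w) (≢-sym v≢w) (≢-sym u≢x) (≢-sym v≢x) u≢v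
    wx∈G uv∈G (trans (sym G w v) vw∉G) (trans (sym G x u) ux∉G) H≗switch′
  where
  open Switch s
  H≗switch′ : ∀ a b → adj H a b ≡ switch G w x u v a b
  H≗switch′ a b = trans (H≗switch a b) (switch-cong G a b
      (∨-comm (sameEdge a b u v) _)
      (trans (∨-comm (sameEdge a b u x) _) (cong₂ _∨_ (sameEdge-comm a b v w) (sameEdge-comm a b u x))))

Switch-inverse : Switch G H u v w x → Switch H G u x w v
Switch-inverse {G = G} {H} {u} {v} {w} {x} s =
  mkSwitch u≢x u≢w u≢v (≢-sym w≢x) (≢-sym v≢x) (≢-sym v≢w)
    (ux∈H s) (trans (sym H w v) (vw∈H s)) (uv∉H s) (trans (sym H x w) (wx∉H s)) G≗switch
  where
  open Switch s
  G≗switch : ∀ a b → adj G a b ≡ switch H u x w v a b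
  G≗switch a b
    rewrite cong (sameEdge a b u x ∨_) (sameEdge-comm a b w v)
          | cong (sameEdge a b u v ∨_) (sameEdge-comm a b x w)
    with added u v w x a b in add | deleted u v w x a b in del
  ... | true  | _     = G-added s a b add
  ... | false | true  = G-deleted s a b del
  ... | false | false = ≡.sym (H-kept s a b del add)

Switch-functional : Switch G H₁ u v w x → Switch G H₂ u v w x → SameGraph H₁ H₂
Switch-functional s₁ s₂ a b = trans (Switch.H≗switch s₁ a b) (≡.sym (Switch.H≗switch s₂ a b))

Switch-injective : Switch G₁ H u v w x → Switch G₂ H u v w x → SameGraph G₁ G₂
Switch-injective s₁ s₂ = Switch-functional (Switch-inverse s₁) (Switch-inverse s₂)

Switch-incompatible : Switch G₁ H₁ a b c d → Switch G₂ H₁ a b d c → Switch G₂ H₂ a b c d → ⊥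
Switch-incompatible s₁ s₂ s₃
  with () ← trans (≡.sym (ux∈H s₁)) (trans (uw-unchanged s₂) (Switch.ux∉G s₃))

Switch-anchor : Switch G H u v w x → SamePair a b u v ⊎ SamePair a b w x →
                ∃₂ λ c d → Switch G H a b c d
Switch-anchor s (inj₁ same)    = _ , _ , s
Switch-anchor s (inj₁ swapped) = _ , _ , Switch-mirror s
Switch-anchor s (inj₂ same)    = _ , _ , Switch-rotate s
Switch-anchor s (inj₂ swapped) = _ , _ , Switch-mirror (Switch-rotate s)

pigeonhole : (x y z : Bool) → x ≡ y ⊎ x ≡ z ⊎ y ≡ z
pigeonhole false false _     = inj₁ refl
pigeonhole true  true  _     = inj₁ refl
pigeonhole false true  false = inj₂ (inj₁ refl)
pigeonhole true  false true  = inj₂ (inj₁ refl)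
pigeonhole false true  true  = inj₂ (inj₂ refl)
pigeonhole true  false false = inj₂ (inj₂ refl)

module Rewiring {a b c d : Fin n} (ab≉cd : ¬ SamePair a b c d) where

  SwitchAt : Bool → Graph n → Graph n → Set
  SwitchAt false G H = Switch G H a b c d
  SwitchAt true  G H = Switch G H a b d c

  HasBoth HasNeither : Graph n → Set
  HasBoth    G = adj G a b ≡ true  × adj G c d ≡ true
  HasNeither G = adj G a b ≡ false × adj G c d ≡ false

  Switch⇒SwitchAt : Switch G H u v w x → HasBoth G → HasNeither H → ∃ λ t → SwitchAt t G H
  Switch⇒SwitchAt s (ab∈G , cd∈G) (ab∉H , cd∉H) with Switch-anchor s (lost-edge s ab∈G ab∉H)
  ... | _ , _ , s′ with lost-edge s′ cd∈G cd∉H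
  ...   | inj₁ same    = ⊥-elim (ab≉cd same)
  ...   | inj₁ swapped = ⊥-elim (ab≉cd swapped)
  ...   | inj₂ same    = false , s′
  ...   | inj₂ swapped = true , s′

  AdjRG⇒SwitchAt : AdjRG G H → HasBoth G → HasNeither H → ∃ λ t → SwitchAt t G H
  AdjRG⇒SwitchAt (inj₁ G→H) = let _ , _ , _ , _ , s = TwoSwitch⇒Switch G→H in Switch⇒SwitchAt s
  AdjRG⇒SwitchAt (inj₂ H→G) = let _ , _ , _ , _ , s = TwoSwitch⇒Switch H→G in Switch⇒SwitchAt (Switch-inverse s)

  SwitchAt-functional : ∀ {t} → SwitchAt t G H₁ → SwitchAt t G H₂ → SameGraph H₁ H₂
  SwitchAt-functional {t = false} = Switch-functional
  SwitchAt-functional {t = true}  = Switch-functional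

  SwitchAt-injective : ∀ {t} → SwitchAt t G₁ H → SwitchAt t G₂ H → SameGraph G₁ G₂
  SwitchAt-injective {t = false} = Switch-injective
  SwitchAt-injective {t = true}  = Switch-injective

  SwitchAt-coherent : ∀ {t t′} → SwitchAt t G₁ H₁ → SwitchAt t′ G₂ H₁ → SwitchAt t G₂ H₂ → t′ ≡ t
  SwitchAt-coherent {t = false} {false} _ _ _ = refl
  SwitchAt-coherent {t = true}  {true}  _ _ _ = refl
  SwitchAt-coherent {t = false} {true}  s₁ s₂ s₃ = ⊥-elim (Switch-incompatible s₁ s₂ s₃)
  SwitchAt-coherent {t = true}  {false} s₁ s₂ s₃ = ⊥-elim (Switch-incompatible s₁ s₂ s₃)

module _ (R : Fin 4 → Graph n)
         (distinct : ∀ i j → i ≢ j → ¬ SameGraph (R i) (R j))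
         (adjacent : ∀ i j → i ≢ j → AdjRG (R i) (R j))
         {a b c d : Fin n} (ab≉cd : ¬ SamePair a b c d)
         (I : Fin 4 → Bool)
         (ab-pattern : ∀ i → adj (R i) a b ≡ I i)
         (cd-pattern : ∀ i → adj (R i) c d ≡ I i) where
  open Rewiring ab≉cd

  SwitchAt-between : ∀ {i j} → I i ≡ true → I j ≡ false → ∃ λ t → SwitchAt t (R i) (R j)
  SwitchAt-between {i} {j} Ii Ij =
    AdjRG⇒SwitchAt (adjacent i j i≢j) (trans (ab-pattern i) Ii , trans (cd-pattern i) Ii)
                                (trans (ab-pattern j) Ij , trans (cd-pattern j) Ij)
    where
    i≢j : i ≢ j
    i≢j refl with () ← trans (≡.sym Ii) Ij

  -- Index distinctness is taken as False (i ≟F j), which is ⊤ for numerals and hence inferred below.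
  distinct′ : ∀ {i j} → False (i ≟F j) → ¬ SameGraph (R i) (R j)
  distinct′ i≢j = distinct _ _ (toWitnessFalse i≢j)

  one-true : ∀ {k l m o} {l≢m : False (l ≟F m)} {l≢o : False (l ≟F o)} {m≢o : False (m ≟F o)} →
             I k ≡ true → I l ≡ false → I m ≡ false → I o ≡ false → ⊥
  one-true {l≢m = l≢m} {l≢o} {m≢o} Ik Il Im Io
    with SwitchAt-between Ik Il | SwitchAt-between Ik Im | SwitchAt-between Ik Io
  ... | t₁ , s₁ | t₂ , s₂ | t₃ , s₃ with pigeonhole t₁ t₂ t₃
  ... | inj₁ refl        = distinct′ l≢m (SwitchAt-functional s₁ s₂)
  ... | inj₂ (inj₁ refl) = distinct′ l≢o (SwitchAt-functional s₁ s₃)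
  ... | inj₂ (inj₂ refl) = distinct′ m≢o (SwitchAt-functional s₂ s₃)

  three-true : ∀ {k l m o} {k≢l : False (k ≟F l)} {k≢m : False (k ≟F m)} {l≢m : False (l ≟F m)} →
               I k ≡ true → I l ≡ true → I m ≡ true → I o ≡ false → ⊥
  three-true {k≢l = k≢l} {k≢m} {l≢m} Ik Il Im Io
    with SwitchAt-between Ik Io | SwitchAt-between Il Io | SwitchAt-between Im Io
  ... | t₁ , s₁ | t₂ , s₂ | t₃ , s₃ with pigeonhole t₁ t₂ t₃
  ... | inj₁ refl        = distinct′ k≢l (SwitchAt-injective s₁ s₂)
  ... | inj₂ (inj₁ refl) = distinct′ k≢m (SwitchAt-injective s₁ s₃)
  ... | inj₂ (inj₂ refl) = distinct′ l≢m (SwitchAt-injective s₂ s₃)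

  two-true : ∀ {k l m o} {k≢l : False (k ≟F l)} {m≢o : False (m ≟F o)} →
             I k ≡ true → I l ≡ true → I m ≡ false → I o ≡ false → ⊥
  two-true {k≢l = k≢l} {m≢o} Ik Il Im Io
    with SwitchAt-between Ik Im | SwitchAt-between Il Im | SwitchAt-between Il Io
  ... | t₁ , s₁ | t₂ , s₂ | t₃ , s₃ with pigeonhole t₁ t₂ t₃
  ... | inj₁ refl        = distinct′ k≢l (SwitchAt-injective s₁ s₂)
  ... | inj₂ (inj₁ refl) with refl ← SwitchAt-coherent s₁ s₂ s₃ = distinct′ k≢l (SwitchAt-injective s₁ s₂)
  ... | inj₂ (inj₂ refl) = distinct′ m≢o (SwitchAt-functional s₂ s₃)

  pattern-constant : ∀ {t} → I 0F ≡ t → I 1F ≡ t → I 2F ≡ t → I 3F ≡ t → ∀ i → I i ≡ t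
  pattern-constant I₀ _  _  _  0F = I₀
  pattern-constant _  I₁ _  _  1F = I₁
  pattern-constant _  _  I₂ _  2F = I₂
  pattern-constant _  _  _  I₃ 3F = I₃

  proper-pattern-unshared : ∃ (λ i → I i ≡ true) → ∃ (λ j → I j ≡ false) → ⊥
  proper-pattern-unshared (i , Ii) (j , Ij) with I 0F in I₀ | I 1F in I₁ | I 2F in I₂ | I 3F in I₃
  ... | true  | true  | true  | true  with () ← trans (≡.sym (pattern-constant I₀ I₁ I₂ I₃ j)) Ij
  ... | false | false | false | false with () ← trans (≡.sym (pattern-constant I₀ I₁ I₂ I₃ i)) Ii
  ... | true  | false | false | false = one-true I₀ I₁ I₂ I₃
  ... | false | true  | false | false = one-true I₁ I₀ I₂ I₃
  ... | false | false | true  | false = one-true I₂ I₀ I₁ I₃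
  ... | false | false | false | true  = one-true I₃ I₀ I₁ I₂
  ... | true  | true  | true  | false = three-true I₀ I₁ I₂ I₃
  ... | true  | true  | false | true  = three-true I₀ I₁ I₃ I₂
  ... | true  | false | true  | true  = three-true I₀ I₂ I₃ I₁
  ... | false | true  | true  | true  = three-true I₁ I₂ I₃ I₀
  ... | true  | true  | false | false = two-true I₀ I₁ I₂ I₃
  ... | true  | false | true  | false = two-true I₀ I₂ I₁ I₃
  ... | true  | false | false | true  = two-true I₀ I₃ I₁ I₂
  ... | false | true  | true  | false = two-true I₁ I₂ I₀ I₃
  ... | false | true  | false | true  = two-true I₁ I₃ I₀ I₂
  ... | false | false | true  | true  = two-true I₂ I₃ I₀ I₁

countTrue-map≡0 : (f : A → Bool) {xs : List A} → (∀ {y} → y ∈ xs → f y ≡ false) →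
                  countTrue (map f xs) ≡ 0
countTrue-map≡0 f {[]}     _         = refl
countTrue-map≡0 f {y ∷ xs} all-false rewrite all-false (here refl) = countTrue-map≡0 f (all-false ∘ there)

countTrue-map≤1 : (f : A → Bool) {xs : List A} → Unique xs →
                  (∀ {y z} → y ∈ xs → z ∈ xs → f y ≡ true → f z ≡ true → ¬ y ≢ z) →
                  countTrue (map f xs) ≤ 1
countTrue-map≤1 f {[]}     _                  _           = z≤n
countTrue-map≤1 f {y ∷ xs} (y∉xs AllPairs.∷ xs-unique) at-most-one with f y in fy
... | false = countTrue-map≤1 f xs-unique (λ y∈ z∈ → at-most-one (there y∈) (there z∈))
... | true  = ≤-reflexive (cong suc (countTrue-map≡0 f rest-false))
  where
  rest-false : ∀ {z} → z ∈ xs → f z ≡ false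
  rest-false {z} z∈xs with f z in fz
  ... | false = refl
  ... | true  = ⊥-elim (at-most-one (here refl) (there z∈xs) fy fz (All.lookup y∉xs z∈xs))

concatMap-if≡map-filter : {P : A → Set} (P? : Decidable P) (g : A → B) (xs : List A) →
  concatMap (λ x → if does (P? x) then g x ∷ [] else []) xs ≡ map g (filter P? xs)
concatMap-if≡map-filter P? g []       = refl
concatMap-if≡map-filter P? g (x ∷ xs) with does (P? x)
... | true  = cong (g x ∷_) (concatMap-if≡map-filter P? g xs)
... | false = concatMap-if≡map-filter P? g xs

row : Fin n → List (Fin n × Fin n)
row {n} a = map (a ,_) (filter (λ b → toℕ a <? toℕ b) (allFin n))

pairs≡concat-rows : ∀ n → pairs n ≡ concat (map row (allFin n))
pairs≡concat-rows n =
  cong concat (map-cong (λ a → concatMap-if≡map-filter (λ b → toℕ a <? toℕ b) (a ,_) (allFin n)) (allFin n))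

∈-row : ∀ {z} → z ∈ row a → proj₁ z ≡ a × toℕ a < toℕ (proj₂ z)
∈-row {a = a} z∈ with ∈-map⁻ (a ,_) z∈
... | b , b∈ , refl = refl , proj₂ (∈-filter⁻ (λ b → toℕ a <? toℕ b) {xs = allFin _} b∈)

∈-pairs : (a , b) ∈ pairs n → toℕ a < toℕ b
∈-pairs {n} {a} {b} ab∈ with ∈-concat⁻′ (map row (allFin n)) (subst ((a , b) ∈_) (pairs≡concat-rows n) ab∈)
... | xs , ab∈xs , xs∈rows with ∈-map⁻ row xs∈rows
... | _ , _ , refl with ∈-row ab∈xs
... | refl , a<b = a<b

pairs-unique : ∀ n → Unique (pairs n)
pairs-unique n = subst Unique (≡.sym (pairs≡concat-rows n))
  (Unique.concat⁺ (All.map⁺ (All.universal row-unique (allFin n)))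
                  (AllPairs.map⁺ (AllPairs.map rows-disjoint (Unique.allFin⁺ n))))
  where
  row-unique : (a : Fin n) → Unique (row a)
  row-unique a = Unique.map⁺ (cong proj₂) (Unique.filter⁺ (λ b → toℕ a <? toℕ b) (Unique.allFin⁺ n))
  rows-disjoint : ∀ {a a′ : Fin n} → a ≢ a′ → Disjoint (row a) (row a′)
  rows-disjoint a≢a′ (z∈ , z∈′) = a≢a′ (trans (≡.sym (proj₁ (∈-row z∈))) (proj₁ (∈-row z∈′)))

distinct-pairs-differ : (a , b) ∈ pairs n → (c , d) ∈ pairs n → (a , b) ≢ (c , d) → ¬ SamePair a b c d
distinct-pairs-differ _   _   ab≢cd same    = ab≢cd refl
distinct-pairs-differ ab∈ cd∈ _     swapped = <-asym (∈-pairs ab∈) (∈-pairs cd∈)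

does⇒ : {P : Set} (P? : Dec P) → does P? ≡ true → P
does⇒ (yes p) _ = p

and-map⇒ : (g : A → Bool) {xs : List A} → and (map g xs) ≡ true → ∀ {x} → x ∈ xs → g x ≡ true
and-map⇒ g {y ∷ _} h (here refl) = ∧-conicalˡ (g y) _ h
and-map⇒ g {y ∷ _} h (there x∈)  = and-map⇒ g (∧-conicalʳ (g y) _ h) x∈

lemma4 : (n : ℕ) (d : Fin n → ℕ) (R : Fin 4 → Graph n) →
    (∀ i → IsRealization d (R i)) →
    (∀ i j → i ≢ j → ¬ SameGraph (R i) (R j)) →
    (∀ i j → i ≢ j → AdjRG (R i) (R j)) →
    (I : Fin 4 → Bool) →
    Σ (Fin 4) (λ i → I i ≡ true) → Σ (Fin 4) (λ j → I j ≡ false) →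
    sI R I ≤ 1
lemma4 n _ R _ distinct adjacent I some-true some-false =
  countTrue-map≤1 _ (pairs-unique n) λ {(a , b)} {(c , d)} ab∈ cd∈ ab-in-I cd-in-I ab≢cd →
    proper-pattern-unshared R distinct adjacent
      (distinct-pairs-differ ab∈ cd∈ ab≢cd)
      I (has-pattern ab-in-I) (has-pattern cd-in-I) some-true some-false
  where
  has-pattern : ∀ {a b} → and (map (λ i → does (adj (R i) a b ≟B I i)) (allFin 4)) ≡ true →
                ∀ i → adj (R i) a b ≡ I i
  has-pattern {a} {b} in-I i =
    does⇒ (adj (R i) a b ≟B I i) (and-map⇒ (λ i → does (adj (R i) a b ≟B I i)) in-I (∈-allFin i))
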